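{- Let $S$ and $T$ be association schemes on finite sets $X$ and $Y$, and $\phi$ an admissible morphism from $S$ to $T$. Let $s\in S$. Then for all $x_0\in X$ and $y\in Y$ with $(\phi(x_0),y)\in\phi(s)$, the number of $x\in X$ with $\phi(x)=y$ and $(x_0,x)\in s$ equals $n_s/n_{\phi(s)}$ (in particular this number is a positive integer independent of $x_0$ and $y$).
   Context: An association scheme on a finite set $X$ is a partition $S$ of $X\times X$ into nonempty subsets such that $1_X=\{(x,x)\}\in S$; $s^*=\{(x,y):(y,x)\in s\}\in S$; and for $p,q,r\in S$ there is $a_{pq}^r\ge0$ with $|\{y:(x,y)\in p,(y,z)\in q\}|=a_{pq}^r$ whenever $(x,z)\in r$. The valency $n_s=a_{ss^*}^{1_X}$ equals $|\{y:(x,y)\in s\}|$ for every $x\in X$. A morphism from a scheme $S$ on $X$ to a scheme $T$ on $Y$ is a function $\phi:X\cup S\to Y\cup T$ with $\phi(X)\subseteq Y$, $\phi(S)\subseteq T$, $(\phi(x_1),\phi(x_2))\in\phi(s)$ whenever $(x_1,x_2)\in s$; it is admissible if whenever $(\phi(x),y)\in\phi(s)$ there is $x'\in X$ with $\phi(x')=y$ and $(x,x')\in s$. -}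

module Defs where

open import Data.Nat using (ℕ; zero; suc; _+_)
open import Data.Fin using (Fin; zero; suc)
open import Data.Fin.Properties using (_≟_)
open import Data.Bool using (Bool; true; false; _∧_)
open import Data.Product using (Σ; ∃; ∃₂; _×_; _,_)
open import Relation.Nullary.Decidable using (⌊_⌋)
open import Relation.Binary.PropositionalEquality using (_≡_)

count : {n : ℕ} → (Fin n → Bool) → ℕ
count {zero}  f = 0
count {suc n} f = (if f zero then 1 else 0) + count (λ i → f (suc i))
  where
  if_then_else_ : Bool → ℕ → ℕ → ℕ
  if true  then a else b = a
  if false then a else b = b

-- An association scheme on the finite set X = Fin n.
-- The relations (classes of the partition S of X × X) are indexed by Fin r;
-- rel x y is the unique class containing (x , y).
record Scheme (n : ℕ) : Set where
  field
    r        : ℕ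
    rel      : Fin n → Fin n → Fin r
    nonempty : ∀ s → ∃₂ λ x y → rel x y ≡ s
    one      : Fin r
    one→diag : ∀ x y → rel x y ≡ one → x ≡ y
    diag→one : ∀ x → rel x x ≡ one
    star      : Fin r → Fin r
    star→     : ∀ x y s → rel x y ≡ star s → rel y x ≡ s
    →star     : ∀ x y s → rel y x ≡ s → rel x y ≡ star s
    a        : Fin r → Fin r → Fin r → ℕ
    a-spec   : ∀ p q t x z → rel x z ≡ t →
               count (λ y → ⌊ rel x y ≟ p ⌋ ∧ ⌊ rel y z ≟ q ⌋) ≡ a p q t

  valency : Fin r → ℕ
  valency s = a s (star s) one

open Scheme public

record Morphism {n m : ℕ} (S : Scheme n) (T : Scheme m) : Set where
  field
    pt   : Fin n → Fin m
    rl   : Fin (r S) → Fin (r T)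
    hom  : ∀ x₁ x₂ → rel T (pt x₁) (pt x₂) ≡ rl (rel S x₁ x₂)

open Morphism public

Admissible : {n m : ℕ} {S : Scheme n} {T : Scheme m} → Morphism S T → Set
Admissible {S = S} {T} φ =
  ∀ x s y → rel T (pt φ x) y ≡ rl φ s →
  Σ _ λ x′ → pt φ x′ ≡ y × rel S x x′ ≡ s

-- Fix s ∈ S and x₀ ∈ X, and let K ⊆ Y be the set of y with (φ x₀ , y) ∈ φ s.
-- The fibre over y ∈ K meets s(x₀) = {x : (x₀ , x) ∈ s} in
--   κ = ∑_{t ∈ ker φ} a_{s t}^{s}        (ker φ = {t : φ t = 1_Y})
-- points, a number depending only on s: by admissibility the fibre contains
-- some x₁ with (x₀ , x₁) ∈ s, and φ x = φ x₁ holds exactly when the class of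
-- (x , x₁) lies in ker φ; splitting by that class counts intersection numbers.
-- Since φ maps s(x₀) into K, counting s(x₀) fibre by fibre gives
--   n_s = ∑_{y ∈ K} κ = n_{φ s} · κ,
-- and the corollary follows.
module Submission where

open import Defs
open import Data.Nat using (ℕ; zero; suc; _+_; _*_)
open import Data.Nat.Properties
  using (+-*-semiring; *-comm; *-assoc; *-identityʳ; *-zeroʳ; +-identityʳ)
open import Data.Fin using (Fin; zero; suc)
open import Data.Fin.Properties using (_≟_)
open import Data.Bool using (Bool; true; false; _∧_)
open import Data.Bool.Properties using (∧-comm)
open import Data.Product using (_,_)
open import Function using (_∘_)
open import Function.Bundles using (_⇔_; mk⇔)
open import Relation.Nullary using (Dec; yes; no; contradiction)
open import Relation.Nullary.Decidable
  using (⌊_⌋; isYes≗does; does-⇔; ⌊⌋-map′)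
open import Relation.Binary.PropositionalEquality
  using (_≡_; refl; sym; trans; cong; cong₂; module ≡-Reasoning)
open import Algebra.Properties.Semiring.Sum +-*-semiring
  using (sum; sum-syntax; sum-cong-≗; sum-replicate-zero; ∑-comm; *-distribˡ-sum; *-distribʳ-sum)

open ≡-Reasoning

𝟙 : Bool → ℕ
𝟙 true  = 1
𝟙 false = 0

𝟙-∧ : (b c : Bool) → 𝟙 (b ∧ c) ≡ 𝟙 b * 𝟙 c
𝟙-∧ true  c = sym (+-identityʳ (𝟙 c))
𝟙-∧ false c = refl

count-as-sum : {n : ℕ} (f : Fin n → Bool) → count f ≡ ∑[ i < n ] 𝟙 (f i)
count-as-sum {zero}  f = refl
count-as-sum {suc n} f with f zero
... | true  = cong suc (count-as-sum (λ i → f (suc i)))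
... | false = count-as-sum (λ i → f (suc i))

count-cong : {n : ℕ} {f g : Fin n → Bool} → (∀ i → f i ≡ g i) → count f ≡ count g
count-cong {f = f} {g} f≗g = begin
  count f            ≡⟨ count-as-sum f ⟩
  sum (𝟙 ∘ f)        ≡⟨ sum-cong-≗ (cong 𝟙 ∘ f≗g) ⟩
  sum (𝟙 ∘ g)        ≡⟨ sym (count-as-sum g) ⟩
  count g            ∎

sum-point : {k : ℕ} (h : Fin k → ℕ) (a : Fin k) →
  ∑[ j < k ] (h j * 𝟙 ⌊ a ≟ j ⌋) ≡ h a
sum-point {suc k} h zero = begin
  h zero * 1 + ∑[ j < k ] (h (suc j) * 0)  ≡⟨ cong₂ _+_ (*-identityʳ (h zero)) (sum-cong-≗ (λ j → *-zeroʳ (h (suc j)))) ⟩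
  h zero + ∑[ j < k ] 0                    ≡⟨ cong (h zero +_) (sum-replicate-zero k) ⟩
  h zero + 0                               ≡⟨ +-identityʳ (h zero) ⟩
  h zero                                   ∎
sum-point {suc k} h (suc a) = begin
  h zero * 0 + ∑[ j < k ] (h (suc j) * 𝟙 ⌊ suc a ≟ suc j ⌋)
    ≡⟨ cong₂ _+_ (*-zeroʳ (h zero)) (sum-cong-≗ (λ j → cong (λ b → h (suc j) * 𝟙 b) (⌊⌋-map′ _ _ (a ≟ j)))) ⟩
  ∑[ j < k ] (h (suc j) * 𝟙 ⌊ a ≟ j ⌋)
    ≡⟨ sum-point (λ j → h (suc j)) a ⟩
  h (suc a) ∎

count-by-class : {n k : ℕ} (P : Fin n → Bool) (g : Fin n → Fin k) (K : Fin k → Bool) →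
  count (λ i → P i ∧ K (g i)) ≡ ∑[ j < k ] (𝟙 (K j) * count (λ i → P i ∧ ⌊ g i ≟ j ⌋))
count-by-class {n} {k} P g K = begin
  count (λ i → P i ∧ K (g i))
    ≡⟨ count-as-sum (λ i → P i ∧ K (g i)) ⟩
  ∑[ i < n ] 𝟙 (P i ∧ K (g i))
    ≡⟨ sum-cong-≗ split-point ⟩
  ∑[ i < n ] ∑[ j < k ] (𝟙 (K j) * 𝟙 (P i ∧ ⌊ g i ≟ j ⌋))
    ≡⟨ ∑-comm (λ i j → 𝟙 (K j) * 𝟙 (P i ∧ ⌊ g i ≟ j ⌋)) ⟩
  ∑[ j < k ] ∑[ i < n ] (𝟙 (K j) * 𝟙 (P i ∧ ⌊ g i ≟ j ⌋))
    ≡⟨ sum-cong-≗ (λ j → sym (*-distribˡ-sum (𝟙 (K j)) (λ i → 𝟙 (P i ∧ ⌊ g i ≟ j ⌋)))) ⟩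
  ∑[ j < k ] (𝟙 (K j) * ∑[ i < n ] 𝟙 (P i ∧ ⌊ g i ≟ j ⌋))
    ≡⟨ sum-cong-≗ (λ j → cong (𝟙 (K j) *_) (sym (count-as-sum (λ i → P i ∧ ⌊ g i ≟ j ⌋)))) ⟩
  ∑[ j < k ] (𝟙 (K j) * count (λ i → P i ∧ ⌊ g i ≟ j ⌋)) ∎
  where
  split-point : ∀ i → 𝟙 (P i ∧ K (g i)) ≡ ∑[ j < k ] (𝟙 (K j) * 𝟙 (P i ∧ ⌊ g i ≟ j ⌋))
  split-point i = sym (begin
    ∑[ j < k ] (𝟙 (K j) * 𝟙 (P i ∧ ⌊ g i ≟ j ⌋))
      ≡⟨ sum-cong-≗ (λ j → trans (cong (𝟙 (K j) *_) (𝟙-∧ (P i) _)) (sym (*-assoc (𝟙 (K j)) _ _))) ⟩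
    ∑[ j < k ] (𝟙 (K j) * 𝟙 (P i) * 𝟙 ⌊ g i ≟ j ⌋)
      ≡⟨ sum-point (λ j → 𝟙 (K j) * 𝟙 (P i)) (g i) ⟩
    𝟙 (K (g i)) * 𝟙 (P i)
      ≡⟨ trans (*-comm (𝟙 (K (g i))) _) (sym (𝟙-∧ (P i) _)) ⟩
    𝟙 (P i ∧ K (g i)) ∎)

weighted-sum-cong : {k : ℕ} {A : Fin k → Set} (A? : ∀ j → Dec (A j)) {f g : Fin k → ℕ} →
  (∀ j → A j → f j ≡ g j) →
  ∑[ j < k ] (𝟙 ⌊ A? j ⌋ * f j) ≡ ∑[ j < k ] (𝟙 ⌊ A? j ⌋ * g j)
weighted-sum-cong A? {f} {g} f≗g = sum-cong-≗ agree
  where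
  agree : ∀ j → 𝟙 ⌊ A? j ⌋ * f j ≡ 𝟙 ⌊ A? j ⌋ * g j
  agree j with A? j
  ... | yes a = cong (1 *_) (f≗g j a)
  ... | no _  = refl

weighted-sum-const : {k : ℕ} (K : Fin k → Bool) (c : ℕ) →
  ∑[ j < k ] (𝟙 (K j) * c) ≡ count K * c
weighted-sum-const K c = begin
  sum (λ j → 𝟙 (K j) * c)   ≡⟨ sym (*-distribʳ-sum c (𝟙 ∘ K)) ⟩
  sum (𝟙 ∘ K) * c            ≡⟨ cong (_* c) (sym (count-as-sum K)) ⟩
  count K * c                ∎

⌊⌋-⇔ : {A B : Set} → A ⇔ B → (A? : Dec A) (B? : Dec B) → ⌊ A? ⌋ ≡ ⌊ B? ⌋
⌊⌋-⇔ A⇔B A? B? = trans (isYes≗does A?) (trans (does-⇔ A⇔B A? B?) (sym (isYes≗does B?)))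

⌊⌋-∧-implied : {A B : Set} (A? : Dec A) (B? : Dec B) → (A → B) → ⌊ A? ⌋ ≡ ⌊ A? ⌋ ∧ ⌊ B? ⌋
⌊⌋-∧-implied (yes _) (yes _) A→B = refl
⌊⌋-∧-implied (yes a) (no ¬b) A→B = contradiction (A→B a) ¬b
⌊⌋-∧-implied (no _)  B?      A→B = refl

-- The valency n_s counts the s-neighbours {x : (x₀ , x) ∈ s} of any point x₀:
-- a_{s s*}^{1} at (x₀ , x₀) counts x with (x₀ , x) ∈ s and (x , x₀) ∈ s*,
-- and the second condition follows from the first.
valency-as-count : {n : ℕ} (S : Scheme n) (s : Fin (r S)) (x₀ : Fin n) →
  valency S s ≡ count (λ x → ⌊ rel S x₀ x ≟ s ⌋)
valency-as-count S s x₀ = begin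
  valency S s
    ≡⟨ sym (a-spec S s (star S s) (one S) x₀ x₀ (diag→one S x₀)) ⟩
  count (λ x → ⌊ rel S x₀ x ≟ s ⌋ ∧ ⌊ rel S x x₀ ≟ star S s ⌋)
    ≡⟨ count-cong (λ x → sym (⌊⌋-∧-implied (rel S x₀ x ≟ s) (rel S x x₀ ≟ star S s) (→star S x x₀ s))) ⟩
  count (λ x → ⌊ rel S x₀ x ≟ s ⌋) ∎

module _ {n m : ℕ} {S : Scheme n} {T : Scheme m} (φ : Morphism S T) where

  inKernel : Fin (r S) → Bool
  inKernel t = ⌊ rl φ t ≟ one T ⌋

  same-image⇔kernel : ∀ x x₁ → (pt φ x ≡ pt φ x₁) ⇔ (rl φ (rel S x x₁) ≡ one T)
  same-image⇔kernel x x₁ = mk⇔ to (one→diag T (pt φ x) (pt φ x₁) ∘ trans (hom φ x x₁))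
    where
    to : pt φ x ≡ pt φ x₁ → rl φ (rel S x x₁) ≡ one T
    to same = begin
      rl φ (rel S x x₁)          ≡⟨ sym (hom φ x x₁) ⟩
      rel T (pt φ x) (pt φ x₁)   ≡⟨ cong (λ y → rel T y (pt φ x₁)) same ⟩
      rel T (pt φ x₁) (pt φ x₁)  ≡⟨ diag→one T (pt φ x₁) ⟩
      one T                      ∎

  fibreSize : Fin (r S) → ℕ
  fibreSize s = ∑[ t < r S ] (𝟙 (inKernel t) * a S s t s)

  -- Admissibility provides x₁
  -- in that intersection; the other points x are those with (x₀ , x) ∈ s and
  -- class of (x , x₁) in the kernel, counted class by class.
  fibre-count : Admissible φ → (s : Fin (r S)) (x₀ : Fin n) (y : Fin m) →
    rel T (pt φ x₀) y ≡ rl φ s →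
    count (λ x → ⌊ rel S x₀ x ≟ s ⌋ ∧ ⌊ pt φ x ≟ y ⌋) ≡ fibreSize s
  fibre-count adm s x₀ y neighbour with adm x₀ s y neighbour
  ... | x₁ , refl , x₀x₁∈s = begin
    count (λ x → ⌊ rel S x₀ x ≟ s ⌋ ∧ ⌊ pt φ x ≟ pt φ x₁ ⌋)
      ≡⟨ count-cong (λ x → cong (⌊ rel S x₀ x ≟ s ⌋ ∧_)
           (⌊⌋-⇔ (same-image⇔kernel x x₁) (pt φ x ≟ pt φ x₁) (rl φ (rel S x x₁) ≟ one T))) ⟩
    count (λ x → ⌊ rel S x₀ x ≟ s ⌋ ∧ inKernel (rel S x x₁))
      ≡⟨ count-by-class (λ x → ⌊ rel S x₀ x ≟ s ⌋) (λ x → rel S x x₁) inKernel ⟩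
    ∑[ t < r S ] (𝟙 (inKernel t) * count (λ x → ⌊ rel S x₀ x ≟ s ⌋ ∧ ⌊ rel S x x₁ ≟ t ⌋))
      ≡⟨ sum-cong-≗ (λ t → cong (𝟙 (inKernel t) *_) (a-spec S s t s x₀ x₁ x₀x₁∈s)) ⟩
    fibreSize s ∎

  -- n_s = n_{φ s} · κ_s: φ maps the s-neighbourhood of a point x₀ into the
  -- φ(s)-neighbourhood K of φ x₀, and each fibre over K contributes κ_s.
  valency-factorisation : Admissible φ → (s : Fin (r S)) →
    valency S s ≡ valency T (rl φ s) * fibreSize s
  valency-factorisation adm s with nonempty S s
  ... | x₀ , _ , _ = begin
    valency S s
      ≡⟨ valency-as-count S s x₀ ⟩
    count (λ x → ⌊ rel S x₀ x ≟ s ⌋)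
      ≡⟨ count-cong (λ x → ⌊⌋-∧-implied (rel S x₀ x ≟ s) (K? (pt φ x)) (image-in-K x)) ⟩
    count (λ x → ⌊ rel S x₀ x ≟ s ⌋ ∧ ⌊ K? (pt φ x) ⌋)
      ≡⟨ count-by-class (λ x → ⌊ rel S x₀ x ≟ s ⌋) (pt φ) (λ y → ⌊ K? y ⌋) ⟩
    ∑[ y < m ] (𝟙 ⌊ K? y ⌋ * count (λ x → ⌊ rel S x₀ x ≟ s ⌋ ∧ ⌊ pt φ x ≟ y ⌋))
      ≡⟨ weighted-sum-cong K? (fibre-count adm s x₀) ⟩
    ∑[ y < m ] (𝟙 ⌊ K? y ⌋ * fibreSize s)
      ≡⟨ weighted-sum-const (λ y → ⌊ K? y ⌋) (fibreSize s) ⟩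
    count (λ y → ⌊ K? y ⌋) * fibreSize s
      ≡⟨ cong (_* fibreSize s) (sym (valency-as-count T (rl φ s) (pt φ x₀))) ⟩
    valency T (rl φ s) * fibreSize s ∎
    where
    K? : ∀ y → Dec (rel T (pt φ x₀) y ≡ rl φ s)
    K? y = rel T (pt φ x₀) y ≟ rl φ s

    image-in-K : ∀ x → rel S x₀ x ≡ s → rel T (pt φ x₀) (pt φ x) ≡ rl φ s
    image-in-K x x₀x∈s = trans (hom φ x₀ x) (cong (rl φ) x₀x∈s)

corollary3p12 : {n m : ℕ} (S : Scheme n) (T : Scheme m) (φ : Morphism S T) →
    Admissible φ → (s : Fin (r S)) (x₀ : Fin n) (y : Fin m) →
    rel T (pt φ x₀) y ≡ rl φ s →
    count (λ x → ⌊ pt φ x ≟ y ⌋ ∧ ⌊ rel S x₀ x ≟ s ⌋) * valency T (rl φ s) ≡ valency S s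
corollary3p12 S T φ adm s x₀ y neighbour = begin
  count (λ x → ⌊ pt φ x ≟ y ⌋ ∧ ⌊ rel S x₀ x ≟ s ⌋) * valency T (rl φ s)
    ≡⟨ cong (_* valency T (rl φ s)) (count-cong (λ x → ∧-comm ⌊ pt φ x ≟ y ⌋ _)) ⟩
  count (λ x → ⌊ rel S x₀ x ≟ s ⌋ ∧ ⌊ pt φ x ≟ y ⌋) * valency T (rl φ s)
    ≡⟨ cong (_* valency T (rl φ s)) (fibre-count φ adm s x₀ y neighbour) ⟩
  fibreSize φ s * valency T (rl φ s)
    ≡⟨ *-comm (fibreSize φ s) _ ⟩
  valency T (rl φ s) * fibreSize φ s
    ≡⟨ sym (valency-factorisation φ adm s) ⟩
  valency S s ∎
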